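{- Let $a, y, b$ be words such that $y$ is overlap-free, and suppose $ayb$ is a cube of period $p$, i.e. $ayb = zzz$ for some word $z$ with $|z| = p > 0$. Then $p \le |ab|$.
   Context: An overlap is a word of the form $cucuc$ where $c$ is a letter and $u$ is a (possibly empty) word. A word is overlap-free if none of its factors (contiguous subwords) is an overlap. $|w|$ denotes the length of a word $w$. -}

module Defs where

open import Level using (Level)
open import Data.List using (List; []; _∷_; _++_; [_])
open import Data.Product using (∃; ∃-syntax; _×_)
open import Relation.Binary.PropositionalEquality using (_≡_)
open import Relation.Nullary using (¬_)

Factor : ∀ {ℓ} {A : Set ℓ} → List A → List A → Set ℓ
Factor {A = A} f w = ∃[ x ] ∃[ v ] (w ≡ x ++ f ++ v)

IsOverlap : ∀ {ℓ} {A : Set ℓ} → List A → Set ℓ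
IsOverlap {A = A} w = ∃[ c ] ∃[ u ] (w ≡ c ∷ u ++ c ∷ u ++ [ c ])

OverlapFree : ∀ {ℓ} {A : Set ℓ} → List A → Set ℓ
OverlapFree w = ∀ f → Factor f w → ¬ IsOverlap f

module Submission where

-- Suppose, to the contrary, that |a| + |b| < |z|.  Cut the
-- period z at position |a|:  z = x c u  with |x| = |a|, so |b| ≤ |u|.
-- Conjugating the cube gives
--     zzz = (xcu)(xcu)(xcu) = x · (c w c w c) · u      where w = u x,
-- and the middle factor  c w c w c  is an overlap.  Comparing with
-- zzz = a y b, the prefixes a and x have the same length, so y b = (c w c w c) u;
-- as b is no longer than u, the overlap c w c w c is a prefix of y,
-- contradicting that y is overlap-free.

open import Defs
open import Level using (Level)
open import Data.Nat using (ℕ; _≤_; _>_; _<_; _+_; zero; suc; s≤s; s≤s⁻¹)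
open import Data.Nat.Properties
  using (suc-injective; ≤-<-trans; +-cancelˡ-<; <⇒≱; ≮⇒≥; module ≤-Reasoning)
open import Data.List using (List; []; _∷_; length; _++_; [_])
open import Data.List.Properties
  using (length-++; length-++-≤ˡ; length-++-≤ʳ; ∷-injective; ∷-injectiveʳ; ++-monoid)
open import Data.Product using (∃-syntax; _×_; _,_; map₂)
open import Relation.Binary.PropositionalEquality using (_≡_; refl; sym; trans; cong)
open import Relation.Nullary using (contradiction)
import Algebra.Solver.Monoid as MonoidSolver

private
  variable
    ℓ : Level
    A : Set ℓ

letter-at : (n : ℕ) (z : List A) → n < length z →
            ∃[ x ] ∃[ c ] ∃[ u ] (z ≡ x ++ c ∷ u × length x ≡ n)
letter-at zero    (c ∷ u) _       = [] , c , u , refl , refl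
letter-at (suc n) (d ∷ z) (s≤s n<|z|) with letter-at n z n<|z|
... | x , c , u , refl , refl = d ∷ x , c , u , refl , refl

cancel-equal-length-prefix : (x x′ r r′ : List A) →
  x ++ r ≡ x′ ++ r′ → length x ≡ length x′ → r ≡ r′
cancel-equal-length-prefix []      []       r r′ eq _ = eq
cancel-equal-length-prefix (_ ∷ x) (_ ∷ x′) r r′ eq |x|≡|x′| =
  cancel-equal-length-prefix x x′ r r′ (∷-injectiveʳ eq) (suc-injective |x|≡|x′|)

prefix-of-longer-tail : (y b f u : List A) →
  y ++ b ≡ f ++ u → length b ≤ length u → ∃[ v ] (y ≡ f ++ v)
prefix-of-longer-tail y       b []      u _  _   = y , refl
prefix-of-longer-tail []      b (d ∷ f) u refl b≤u =
  contradiction b≤u (<⇒≱ (s≤s (length-++-≤ʳ u {f})))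
prefix-of-longer-tail (c ∷ y) b (d ∷ f) u eq b≤u with ∷-injective eq
... | refl , eq′ = map₂ (cong (c ∷_)) (prefix-of-longer-tail y b f u eq′ b≤u)

-- Conjugating a cube: (xcu)³ = x · (c w c w c) · u with w = u x.
-- This is an identity in the free monoid, with the letter c read as [ c ].
cube-rotation : (x u : List A) (c : A) →
  (x ++ c ∷ u) ++ (x ++ c ∷ u) ++ (x ++ c ∷ u)
    ≡ x ++ (c ∷ (u ++ x) ++ c ∷ (u ++ x) ++ [ c ]) ++ u
cube-rotation {A = A} x u c =
  solve 3 (λ x u c → (x ⊕ c ⊕ u) ⊕ (x ⊕ c ⊕ u) ⊕ (x ⊕ c ⊕ u)
                   ⊜ x ⊕ (c ⊕ (u ⊕ x) ⊕ c ⊕ (u ⊕ x) ⊕ c) ⊕ u)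
        refl x u [ c ]
  where open MonoidSolver (++-monoid A)

short-context-overlap : (a y b z : List A) →
  a ++ y ++ b ≡ z ++ z ++ z → length (a ++ b) < length z →
  ∃[ f ] (Factor f y × IsOverlap f)
short-context-overlap a y b z cube |ab|<|z|
  with letter-at (length a) z (≤-<-trans (length-++-≤ˡ a) |ab|<|z|)
... | x , c , u , refl , |x|≡|a| = cwcwc , cwcwc-factor , (c , u ++ x , refl)
  where
  cwcwc : List _
  cwcwc = c ∷ (u ++ x) ++ c ∷ (u ++ x) ++ [ c ]

  |b|≤|u| : length b ≤ length u
  |b|≤|u| = s≤s⁻¹ (+-cancelˡ-< (length a) (length b) (suc (length u)) (begin-strict
    length a + length b       ≡⟨ length-++ a ⟨
    length (a ++ b)           <⟨ |ab|<|z| ⟩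
    length (x ++ c ∷ u)       ≡⟨ length-++ x ⟩
    length x + suc (length u) ≡⟨ cong (_+ suc (length u)) |x|≡|a| ⟩
    length a + suc (length u) ∎))
    where open ≤-Reasoning

  y++b≡cwcwc++u : y ++ b ≡ cwcwc ++ u
  y++b≡cwcwc++u = cancel-equal-length-prefix a x (y ++ b) (cwcwc ++ u)
    (trans cube (cube-rotation x u c)) (sym |x|≡|a|)

  cwcwc-factor : Factor cwcwc y
  cwcwc-factor =
    let v , y≡cwcwc++v = prefix-of-longer-tail y b cwcwc u y++b≡cwcwc++u |b|≤|u|
    in  [] , v , y≡cwcwc++v

-- Lemma 4: the period of a cube a y b with y overlap-free is at most |ab|.
lemma4 : ∀ {ℓ} {A : Set ℓ} (a y b z : List A) → OverlapFree y → a ++ y ++ b ≡ z ++ z ++ z → length z > 0 → length z ≤ length (a ++ b)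
lemma4 a y b z y-overlap-free cube _ = ≮⇒≥ λ |ab|<|z| →
  let f , f-factor , f-overlap = short-context-overlap a y b z cube |ab|<|z|
  in  y-overlap-free f f-factor f-overlap
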